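{- Let $A$ be any element of a commutative ring with identity. For any integer $n\ge2$, $$\det[u_{|j-k|}(A,2A-1)]_{1\le j,k\le n}=\det[u_{|j-k|}(A,-2A-1)]_{1\le j,k\le n}=\left(\frac{1-n}{3}\right)(2A)^{n-2}.$$
   Context: For elements $x,y$ of a commutative ring with identity, the Lucas sequence $(u_n(x,y))_{n\ge0}$ is defined by $u_0(x,y)=0$, $u_1(x,y)=1$, and $u_{n+1}(x,y)=xu_n(x,y)-yu_{n-1}(x,y)$ for $n\ge1$. For an integer $m$, $\left(\frac{m}{3}\right)$ is the Legendre symbol modulo $3$: it equals $0$ if $3\mid m$, $1$ if $m\equiv1\pmod 3$, and $-1$ if $m\equiv2\pmod3$. The convention $0^0=1$ is used. -}

module Defs where

open import Level using (Level)
open import Algebra.Bundles using (CommutativeRing)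
open import Data.Nat as ℕ using (ℕ; zero; suc; ∣_-_∣; _%_)
open import Data.Fin using (Fin; zero; suc; toℕ; punchIn)

module _ {c ℓ : Level} (R : CommutativeRing c ℓ) where
  open CommutativeRing R hiding (zero)

  lucas : Carrier → Carrier → ℕ → Carrier
  lucas x y zero = 0#
  lucas x y (suc zero) = 1#
  lucas x y (suc (suc n)) = x * lucas x y (suc n) - y * lucas x y n

  sgn : ℕ → Carrier
  sgn zero = 1#
  sgn (suc i) = - sgn i

  sumFin : ∀ n → (Fin n → Carrier) → Carrier
  sumFin zero f = 0#
  sumFin (suc n) f = f zero + sumFin n (λ i → f (suc i))

  det : ∀ n → (Fin n → Fin n → Carrier) → Carrier
  det zero M = 1#
  det (suc n) M =
    sumFin (suc n) (λ k → sgn (toℕ k) * (M zero k * det n (λ a b → M (suc a) (punchIn k b))))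

  -- Legendre symbol (m/3) for m = 1 - n (as an integer), given as a ring element
  -- 1 - n ≡ 0 (mod 3) iff n ≡ 1; ≡ 1 iff n ≡ 0; ≡ 2 (i.e. -1) iff n ≡ 2
  legendre1-n/3 : ℕ → Carrier
  legendre1-n/3 n with n % 3
  ... | 0 = 1#
  ... | 1 = 0#
  ... | _ = - 1#

  lucasToeplitz : Carrier → Carrier → ∀ n → Fin n → Fin n → Carrier
  lucasToeplitz x y n j k = lucas x y ∣ toℕ j - toℕ k ∣

  two : Carrier
  two = 1# + 1#

  pow : Carrier → ℕ → Carrier
  pow x zero = 1#
  pow x (suc n) = x * pow x n

{-# OPTIONS --safe #-}

-- Let U be the n × n matrix [u_{|j-k|}(x, y)]. Adding -x times line k-1 and y times line k-2 to
-- every line k ≥ 2, first for the columns and then for the rows, leaves the determinant unchanged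
-- and, by the recurrence of u, turns U into the tridiagonal matrix with diagonal -2x and
-- off-diagonal 1 + y, bordered by two rows and columns (0, 1, 0, …) and (1, 0, 1 + y, 0, …).
-- Hence det U = -u_{n-1}(-2x, (1+y)²). For y = ±2A - 1 we have (1+y)² = (2A)², so
-- u_{n-1}(-2A, (2A)²) = (2A)^{n-2} u_{n-1}(-1, 1), and u_k(-1, 1) = 0, 1, -1, 0, 1, -1, … gives the
-- Legendre symbol. With det defined by expansion along the first row, the line operations rest on
-- linearity in every row and column and on vanishing when two adjacent rows or columns agree.

module Submission where

open import Defs
open import Level using (Level; _⊔_)
open import Algebra.Bundles using (CommutativeRing)
open import Algebra.Solver.Ring.AlmostCommutativeRing using (fromCommutativeRing; _-Raw-AlmostCommutative⟶_)
open import Data.Nat as ℕ using (ℕ; zero; suc; _≤_; _<_; _∸_; ∣_-_∣; z≤n; s≤s)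
import Data.Nat.Properties as ℕ
open import Data.Nat.DivMod using ([m+n]%n≡m%n)
open import Data.Integer as ℤ using (ℤ; +_; -[1+_]; _⊖_; sign)
import Data.Integer.Properties as ℤ
open import Data.Sign as Sign using (Sign)
open import Data.Maybe using (Maybe; just; nothing)
open import Data.Product using (_×_; _,_; ∃₂; proj₁; proj₂)
open import Data.Sum using (_⊎_; inj₁; inj₂)
open import Relation.Binary.PropositionalEquality as ≡ using (_≡_; _≢_)
open import Relation.Nullary using (yes; no; contradiction)
open import Data.Fin using (Fin; zero; suc; toℕ; fromℕ<; punchIn; punchOut)
import Data.Fin.Properties as Fin
open import Data.Fin.Properties
  using (punchIn-punchOut; punchInᵢ≢i; punchIn-injective; toℕ<n; toℕ-fromℕ<; toℕ-injective)
open import Function using (_∘_; flip)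

module _ {c ℓ : Level} (R : CommutativeRing c ℓ) where
  open CommutativeRing R hiding (zero)
  open import Algebra.Properties.Ring ring using (-1*x≈-x)
  open import Algebra.Properties.AbelianGroup +-abelianGroup using (⁻¹-∙-comm; ⁻¹-involutive; ε⁻¹≈ε)
  open import Algebra.Properties.CommutativeSemigroup +-commutativeSemigroup using (interchange; x∙yz≈y∙xz)
  open import Algebra.Properties.CommutativeSemigroup *-commutativeSemigroup
    using () renaming (interchange to *-interchange)
  open import Algebra.Properties.Semiring.Mult.TCOptimised semiring
    using (1+×; ×-homo-+; ×1-homo-*) renaming (_×_ to _·_)
  open import Relation.Binary.Reasoning.Setoid setoid

  -- Coefficients for Algebra.Solver.Ring: the solver needs decidable equality of coefficients, which R
  -- lacks, so it works over ℤ through the canonical map. The optimised _·_ makes ⟦ + 1 ⟧ℤ reduce to 1#.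
  ⟦_⟧ℤ : ℤ → Carrier
  ⟦ + n ⟧ℤ = n · 1#
  ⟦ -[1+ n ] ⟧ℤ = - (suc n · 1#)

  ⊖-homo : ∀ m n → ⟦ m ⊖ n ⟧ℤ ≈ m · 1# - n · 1#
  ⊖-homo m zero = sym (trans (+-congˡ ε⁻¹≈ε) (+-identityʳ _))
  ⊖-homo zero (suc n) = sym (+-identityˡ _)
  ⊖-homo (suc m) (suc n) = begin
    ⟦ suc m ⊖ suc n ⟧ℤ                  ≡⟨ ≡.cong ⟦_⟧ℤ (ℤ.[1+m]⊖[1+n]≡m⊖n m n) ⟩
    ⟦ m ⊖ n ⟧ℤ                          ≈⟨ ⊖-homo m n ⟩
    m · 1# - n · 1#                     ≈⟨ +-identityˡ _ ⟨
    0# + (m · 1# - n · 1#)              ≈⟨ +-congʳ (-‿inverseʳ 1#) ⟨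
    (1# - 1#) + (m · 1# - n · 1#)       ≈⟨ interchange _ _ _ _ ⟩
    (1# + m · 1#) + (- 1# - n · 1#)     ≈⟨ +-congˡ (⁻¹-∙-comm _ _) ⟩
    (1# + m · 1#) - (1# + n · 1#)       ≈⟨ +-cong (1+× m 1#) (-‿cong (1+× n 1#)) ⟨
    suc m · 1# - suc n · 1#             ∎

  sign⟦_⟧ : Sign → Carrier
  sign⟦ Sign.+ ⟧ = 1#
  sign⟦ Sign.- ⟧ = - 1#

  sign-homo : ∀ s t → sign⟦ s Sign.* t ⟧ ≈ sign⟦ s ⟧ * sign⟦ t ⟧
  sign-homo Sign.- Sign.- = sym (trans (-1*x≈-x _) (⁻¹-involutive _))
  sign-homo Sign.- Sign.+ = sym (*-identityʳ _)
  sign-homo Sign.+ t = sym (*-identityˡ _)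

  ◃-homo : ∀ s n → ⟦ s ℤ.◃ n ⟧ℤ ≈ sign⟦ s ⟧ * (n · 1#)
  ◃-homo s zero = sym (zeroʳ _)
  ◃-homo Sign.- (suc n) = sym (-1*x≈-x _)
  ◃-homo Sign.+ (suc n) = sym (*-identityˡ _)

  sign-abs-homo : ∀ i → ⟦ i ⟧ℤ ≈ sign⟦ sign i ⟧ * (ℤ.∣ i ∣ · 1#)
  sign-abs-homo -[1+ n ] = sym (-1*x≈-x _)
  sign-abs-homo (+ n) = sym (*-identityˡ _)

  ℤ⟶R : ℤ.+-*-rawRing -Raw-AlmostCommutative⟶ fromCommutativeRing R
  ℤ⟶R = record
    { ⟦_⟧ = ⟦_⟧ℤ
    ; +-homo = +-homo
    ; *-homo = *-homo
    ; -‿homo = -‿homo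
    ; 0-homo = refl
    ; 1-homo = refl
    }
    where
    +-homo : ∀ i j → ⟦ i ℤ.+ j ⟧ℤ ≈ ⟦ i ⟧ℤ + ⟦ j ⟧ℤ
    +-homo -[1+ m ] -[1+ n ] = begin
      - (suc (suc m ℕ.+ n) · 1#)          ≡⟨ ≡.cong (λ k → - (suc k · 1#)) (ℕ.+-suc m n) ⟨
      - ((suc m ℕ.+ suc n) · 1#)          ≈⟨ -‿cong (×-homo-+ 1# (suc m) (suc n)) ⟩
      - (suc m · 1# + suc n · 1#)         ≈⟨ ⁻¹-∙-comm _ _ ⟨
      - (suc m · 1#) - suc n · 1#         ∎
    +-homo -[1+ m ] (+ n) = trans (⊖-homo n (suc m)) (+-comm _ _)
    +-homo (+ m) -[1+ n ] = ⊖-homo m (suc n)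
    +-homo (+ m) (+ n) = ×-homo-+ 1# m n
    *-homo : ∀ i j → ⟦ i ℤ.* j ⟧ℤ ≈ ⟦ i ⟧ℤ * ⟦ j ⟧ℤ
    *-homo i j = begin
      ⟦ (sign i Sign.* sign j) ℤ.◃ (ℤ.∣ i ∣ ℕ.* ℤ.∣ j ∣) ⟧ℤ
        ≈⟨ ◃-homo (sign i Sign.* sign j) (ℤ.∣ i ∣ ℕ.* ℤ.∣ j ∣) ⟩
      sign⟦ sign i Sign.* sign j ⟧ * ((ℤ.∣ i ∣ ℕ.* ℤ.∣ j ∣) · 1#)
        ≈⟨ *-cong (sign-homo (sign i) (sign j)) (×1-homo-* ℤ.∣ i ∣ ℤ.∣ j ∣) ⟩
      (sign⟦ sign i ⟧ * sign⟦ sign j ⟧) * ((ℤ.∣ i ∣ · 1#) * (ℤ.∣ j ∣ · 1#))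
        ≈⟨ *-interchange _ _ _ _ ⟩
      (sign⟦ sign i ⟧ * (ℤ.∣ i ∣ · 1#)) * (sign⟦ sign j ⟧ * (ℤ.∣ j ∣ · 1#))
        ≈⟨ *-cong (sign-abs-homo i) (sign-abs-homo j) ⟨
      ⟦ i ⟧ℤ * ⟦ j ⟧ℤ ∎
    -‿homo : ∀ i → ⟦ ℤ.- i ⟧ℤ ≈ - ⟦ i ⟧ℤ
    -‿homo -[1+ n ] = sym (⁻¹-involutive _)
    -‿homo (+ zero) = sym ε⁻¹≈ε
    -‿homo (+ suc n) = refl

  ⟦⟧ℤ-equal? : ∀ i j → Maybe (⟦ i ⟧ℤ ≈ ⟦ j ⟧ℤ)
  ⟦⟧ℤ-equal? i j with i ℤ.≟ j
  ... | yes ≡.refl = just refl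
  ... | no _ = nothing

  open import Algebra.Solver.Ring ℤ.+-*-rawRing (fromCommutativeRing R) ℤ⟶R ⟦⟧ℤ-equal?
    using (solve; _:=_; _:+_; _:*_; _:-_; :-_; con; Polynomial)

  O I : ∀ {k} → Polynomial k
  O = con (+ 0)
  I = con (+ 1)

  Matrix : ℕ → Set c
  Matrix n = Fin n → Fin n → Carrier

  minor : ∀ {n} → Matrix (suc n) → Fin (suc n) → Matrix n
  minor M k i j = M (suc i) (punchIn k j)

  laplaceTerm : ∀ {n} → Matrix (suc n) → Fin (suc n) → Carrier
  laplaceTerm {n} M k = sgn R (toℕ k) * (M zero k * det R n (minor M k))

  laplaceTerm-vanishes : ∀ {n} (M : Matrix (suc n)) k → det R n (minor M k) ≈ 0# → laplaceTerm M k ≈ 0#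
  laplaceTerm-vanishes M k minor≈0 =
    trans (*-congˡ (*-congˡ minor≈0)) (solve 2 (λ s m → s :* (m :* O) := O) refl _ _)

  ∑-cong : ∀ n {f g : Fin n → Carrier} → (∀ i → f i ≈ g i) → sumFin R n f ≈ sumFin R n g
  ∑-cong zero f≈g = refl
  ∑-cong (suc n) f≈g = +-cong (f≈g zero) (∑-cong n (λ i → f≈g (suc i)))

  ∑-zero : ∀ n {f : Fin n → Carrier} → (∀ i → f i ≈ 0#) → sumFin R n f ≈ 0#
  ∑-zero zero f≈0 = refl
  ∑-zero (suc n) f≈0 = trans (+-cong (f≈0 zero) (∑-zero n (λ i → f≈0 (suc i)))) (+-identityʳ 0#)

  ∑-+ : ∀ n (f g : Fin n → Carrier) → sumFin R n (λ i → f i + g i) ≈ sumFin R n f + sumFin R n g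
  ∑-+ zero f g = sym (+-identityʳ 0#)
  ∑-+ (suc n) f g = trans (+-congˡ (∑-+ n _ _)) (interchange _ _ _ _)

  ∑-*ˡ : ∀ n α (f : Fin n → Carrier) → sumFin R n (λ i → α * f i) ≈ α * sumFin R n f
  ∑-*ˡ zero α f = sym (zeroʳ α)
  ∑-*ˡ (suc n) α f = trans (+-congˡ (∑-*ˡ n α _)) (sym (distribˡ α _ _))

  ∑-linear : ∀ n α (f g : Fin n → Carrier) →
             sumFin R n (λ i → f i + α * g i) ≈ sumFin R n f + α * sumFin R n g
  ∑-linear n α f g = trans (∑-+ n f _) (+-congˡ (∑-*ˡ n α g))

  ∑-punchIn : ∀ n (k : Fin (suc n)) (f : Fin (suc n) → Carrier) →
              sumFin R (suc n) f ≈ f k + sumFin R n (λ l → f (punchIn k l))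
  ∑-punchIn n zero f = refl
  ∑-punchIn (suc n) (suc k) f =
    trans (+-congˡ (∑-punchIn n k (λ i → f (suc i)))) (x∙yz≈y∙xz _ _ _)

  ∑-pair : ∀ n (f : Fin n → Carrier) {a b : Fin n} → a ≢ b →
           (∀ k → k ≢ a → k ≢ b → f k ≈ 0#) → f a + f b ≈ 0# → sumFin R n f ≈ 0#
  ∑-pair (suc zero) f {zero} {zero} a≢b _ _ = contradiction ≡.refl a≢b
  ∑-pair (suc (suc n)) f {a} {b} a≢b rest pair = begin
    sumFin R (suc (suc n)) f                       ≈⟨ ∑-punchIn (suc n) a f ⟩
    f a + sumFin R (suc n) (λ l → f (punchIn a l))  ≈⟨ +-congˡ (∑-punchIn n b′ (f ∘ punchIn a)) ⟩
    f a + (f (punchIn a b′) + sumFin R n (λ l → f (punchIn a (punchIn b′ l))))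
      ≈⟨ +-congˡ (+-cong (reflexive (≡.cong f a↑b′≡b)) (∑-zero n others)) ⟩
    f a + (f b + 0#)                               ≈⟨ trans (+-congˡ (+-identityʳ _)) pair ⟩
    0#                                             ∎
    where
    b′ : Fin (suc n)
    b′ = punchOut a≢b
    a↑b′≡b : punchIn a b′ ≡ b
    a↑b′≡b = punchIn-punchOut a≢b
    others : ∀ l → f (punchIn a (punchIn b′ l)) ≈ 0#
    others l = rest (punchIn a (punchIn b′ l)) (punchInᵢ≢i a _)
      (λ eq → punchInᵢ≢i b′ l (punchIn-injective a _ _ (≡.trans eq (≡.sym a↑b′≡b))))

  ∑∑-antisymmetric : ∀ n (g : Fin n → Fin n → Carrier) → (∀ i → g i i ≈ 0#) →
                     (∀ i j → g i j + g j i ≈ 0#) → sumFin R n (λ i → sumFin R n (g i)) ≈ 0#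
  ∑∑-antisymmetric zero g diag anti = refl
  ∑∑-antisymmetric (suc n) g diag anti = begin
    (g zero zero + firstRow) + sumFin R n (λ i → g (suc i) zero + rest i)  ≈⟨ +-congˡ (∑-+ n _ rest) ⟩
    (g zero zero + firstRow) + (firstColumn + sumFin R n rest)          ≈⟨ regroup _ _ _ _ ⟩
    (g zero zero + (firstRow + firstColumn)) + sumFin R n rest
      ≈⟨ +-cong (+-cong (diag zero) firstRow+firstColumn≈0) inner≈0 ⟩
    (0# + 0#) + 0#                                                       ≈⟨ trans (+-identityʳ _) (+-identityʳ 0#) ⟩
    0#                                                                   ∎
    where
    firstRow firstColumn : Carrier
    firstRow = sumFin R n (λ j → g zero (suc j))
    firstColumn = sumFin R n (λ i → g (suc i) zero)
    rest : Fin n → Carrier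
    rest i = sumFin R n (λ j → g (suc i) (suc j))
    regroup : ∀ x a b t → (x + a) + (b + t) ≈ (x + (a + b)) + t
    regroup = solve 4 (λ x a b t → (x :+ a) :+ (b :+ t) := (x :+ (a :+ b)) :+ t) refl
    firstRow+firstColumn≈0 : firstRow + firstColumn ≈ 0#
    firstRow+firstColumn≈0 = trans (sym (∑-+ n _ _)) (∑-zero n (λ j → anti zero (suc j)))
    inner≈0 : sumFin R n rest ≈ 0#
    inner≈0 = ∑∑-antisymmetric n (λ i j → g (suc i) (suc j)) (λ i → diag (suc i)) (λ i j → anti (suc i) (suc j))

  det-cong : ∀ n {M N : Matrix n} → (∀ i j → M i j ≈ N i j) → det R n M ≈ det R n N
  det-cong zero M≈N = refl
  det-cong (suc n) {M} {N} M≈N = ∑-cong (suc n) {laplaceTerm M} {laplaceTerm N} λ k →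
    *-congˡ (*-cong (M≈N zero k) (det-cong n (λ i j → M≈N (suc i) (punchIn k j))))

  laplaceTerm-linear-in-entry :
    ∀ {n} {M N P : Matrix (suc n)} k α → M zero k ≈ N zero k + α * P zero k →
    (∀ i j → minor M k i j ≈ minor N k i j) → (∀ i j → minor M k i j ≈ minor P k i j) →
    laplaceTerm M k ≈ laplaceTerm N k + α * laplaceTerm P k
  laplaceTerm-linear-in-entry {n} {M} {N} {P} k α entry M≈N M≈P = begin
    s * (M zero k * det R n (minor M k))
      ≈⟨ *-congˡ (*-cong entry (det-cong n M≈N)) ⟩
    s * ((N zero k + α * P zero k) * det R n (minor N k))
      ≈⟨ solve 5 (λ s a b d α → s :* ((a :+ α :* b) :* d) := s :* (a :* d) :+ α :* (s :* (b :* d))) refl _ _ _ _ α ⟩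
    s * (N zero k * det R n (minor N k)) + α * (s * (P zero k * det R n (minor N k)))
      ≈⟨ +-congˡ (*-congˡ (*-congˡ (*-congˡ (det-cong n (λ i j → trans (sym (M≈N i j)) (M≈P i j)))))) ⟩
    s * (N zero k * det R n (minor N k)) + α * (s * (P zero k * det R n (minor P k))) ∎
    where s = sgn R (toℕ k)

  laplaceTerm-linear-in-minor :
    ∀ {n} {M N P : Matrix (suc n)} k α → M zero k ≈ N zero k → M zero k ≈ P zero k →
    det R n (minor M k) ≈ det R n (minor N k) + α * det R n (minor P k) →
    laplaceTerm M k ≈ laplaceTerm N k + α * laplaceTerm P k
  laplaceTerm-linear-in-minor {n} {M} {N} {P} k α M≈N M≈P minor-linear = begin
    s * (M zero k * det R n (minor M k))
      ≈⟨ *-congˡ (*-congˡ minor-linear) ⟩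
    s * (M zero k * (det R n (minor N k) + α * det R n (minor P k)))
      ≈⟨ solve 5 (λ s m x y α → s :* (m :* (x :+ α :* y)) := s :* (m :* x) :+ α :* (s :* (m :* y))) refl _ _ _ _ α ⟩
    s * (M zero k * det R n (minor N k)) + α * (s * (M zero k * det R n (minor P k)))
      ≈⟨ +-cong (*-congˡ (*-congʳ M≈N)) (*-congˡ (*-congˡ (*-congʳ M≈P))) ⟩
    s * (N zero k * det R n (minor N k)) + α * (s * (P zero k * det R n (minor P k))) ∎
    where s = sgn R (toℕ k)

  det-linear-termwise : ∀ {n} α {M N P : Matrix (suc n)} →
                        (∀ k → laplaceTerm M k ≈ laplaceTerm N k + α * laplaceTerm P k) →
                        det R (suc n) M ≈ det R (suc n) N + α * det R (suc n) P
  det-linear-termwise {n} α {M} {N} {P} term =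
    trans (∑-cong (suc n) {laplaceTerm M} term) (∑-linear (suc n) α (laplaceTerm N) (laplaceTerm P))

  det-row-linear : ∀ n (r : Fin n) α {M N P : Matrix n} →
                   (∀ i → i ≢ r → ∀ j → M i j ≈ N i j) → (∀ i → i ≢ r → ∀ j → M i j ≈ P i j) →
                   (∀ j → M r j ≈ N r j + α * P r j) → det R n M ≈ det R n N + α * det R n P
  det-row-linear (suc n) zero α {M} {N} {P} M≈N M≈P row₀ = det-linear-termwise α {M} {N} {P} λ k →
    laplaceTerm-linear-in-entry {M = M} {N} {P} k α (row₀ k)
      (λ i → M≈N (suc i) (λ ()) ∘ punchIn k) (λ i → M≈P (suc i) (λ ()) ∘ punchIn k)
  det-row-linear (suc n) (suc r) α {M} {N} {P} M≈N M≈P row-r = det-linear-termwise α {M} {N} {P} λ k →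
    laplaceTerm-linear-in-minor {M = M} {N} {P} k α (M≈N zero (λ ()) k) (M≈P zero (λ ()) k)
      (det-row-linear n r α
        (λ i i≢r → M≈N (suc i) (i≢r ∘ Fin.suc-injective) ∘ punchIn k)
        (λ i i≢r → M≈P (suc i) (i≢r ∘ Fin.suc-injective) ∘ punchIn k)
        (row-r ∘ punchIn k))

  det-column-linear : ∀ n (c : Fin n) α {M N P : Matrix n} →
                      (∀ k → k ≢ c → ∀ i → M i k ≈ N i k) → (∀ k → k ≢ c → ∀ i → M i k ≈ P i k) →
                      (∀ i → M i c ≈ N i c + α * P i c) → det R n M ≈ det R n N + α * det R n P
  det-column-linear (suc n) c α {M} {N} {P} M≈N M≈P column-c = det-linear-termwise α {M} {N} {P} term
    where
    term : ∀ k → laplaceTerm M k ≈ laplaceTerm N k + α * laplaceTerm P k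
    term k with k Fin.≟ c
    ... | yes ≡.refl = laplaceTerm-linear-in-entry {M = M} {N} {P} k α (column-c zero)
                         (λ i j → M≈N (punchIn k j) (punchInᵢ≢i k j) (suc i))
                         (λ i j → M≈P (punchIn k j) (punchInᵢ≢i k j) (suc i))
    ... | no k≢c = laplaceTerm-linear-in-minor {M = M} {N} {P} k α (M≈N k k≢c zero) (M≈P k k≢c zero)
                     (det-column-linear n (punchOut k≢c) α
                       (λ j j≢c′ → M≈N (punchIn k j) (shifted j j≢c′) ∘ suc)
                       (λ j j≢c′ → M≈P (punchIn k j) (shifted j j≢c′) ∘ suc)
                       (λ i → ≡.subst (λ l → M (suc i) l ≈ N (suc i) l + α * P (suc i) l)
                                (≡.sym (punchIn-punchOut k≢c)) (column-c (suc i))))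
      where
      shifted : ∀ j → j ≢ punchOut k≢c → punchIn k j ≢ c
      shifted j j≢c′ eq = j≢c′ (punchIn-injective k _ _ (≡.trans eq (≡.sym (punchIn-punchOut k≢c))))

  adjacent⇒≢ : ∀ {n} {a b : Fin n} → toℕ b ≡ suc (toℕ a) → a ≢ b
  adjacent⇒≢ b≡1+a ≡.refl = ℕ.1+n≢n (≡.sym b≡1+a)

  punchIn-adjacent : ∀ {n} (a b : Fin (suc n)) → toℕ b ≡ suc (toℕ a) → ∀ j →
                     punchIn a j ≡ punchIn b j ⊎ (punchIn a j ≡ b × punchIn b j ≡ a)
  punchIn-adjacent zero (suc zero) _ zero = inj₂ (≡.refl , ≡.refl)
  punchIn-adjacent zero (suc zero) _ (suc j) = inj₁ ≡.refl
  punchIn-adjacent {suc n} (suc a) (suc b) _ zero = inj₁ ≡.refl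
  punchIn-adjacent {suc n} (suc a) (suc b) b≡1+a (suc j)
    with punchIn-adjacent a b (ℕ.suc-injective b≡1+a) j
  ... | inj₁ same = inj₁ (≡.cong suc same)
  ... | inj₂ (a↦b , b↦a) = inj₂ (≡.cong suc a↦b , ≡.cong suc b↦a)

  punchIn-adjacent-preimage :
    ∀ {n} (k a b : Fin (suc n)) → toℕ b ≡ suc (toℕ a) → k ≢ a → k ≢ b →
    ∃₂ λ a′ b′ → punchIn k a′ ≡ a × punchIn k b′ ≡ b × toℕ b′ ≡ suc (toℕ a′)
  punchIn-adjacent-preimage zero zero b _ k≢a _ = contradiction ≡.refl k≢a
  punchIn-adjacent-preimage zero (suc a) (suc b) b≡1+a _ _ =
    a , b , ≡.refl , ≡.refl , ℕ.suc-injective b≡1+a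
  punchIn-adjacent-preimage (suc zero) zero (suc zero) _ _ k≢b = contradiction ≡.refl k≢b
  punchIn-adjacent-preimage {suc (suc n)} (suc (suc k)) zero (suc zero) _ _ _ =
    zero , suc zero , ≡.refl , ≡.refl , ≡.refl
  punchIn-adjacent-preimage {suc n} (suc k) (suc a) (suc b) b≡1+a k≢a k≢b
    with punchIn-adjacent-preimage k a b (ℕ.suc-injective b≡1+a) (k≢a ∘ ≡.cong suc) (k≢b ∘ ≡.cong suc)
  ... | a′ , b′ , k↑a′≡a , k↑b′≡b , b′≡1+a′ =
    suc a′ , suc b′ , ≡.cong suc k↑a′≡a , ≡.cong suc k↑b′≡b , ≡.cong suc b′≡1+a′

  det-adjacent-columns : ∀ n (M : Matrix n) (a b : Fin n) → toℕ b ≡ suc (toℕ a) →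
                         (∀ i → M i a ≈ M i b) → det R n M ≈ 0#
  det-adjacent-columns (suc n) M a b b≡1+a columns-equal =
    ∑-pair (suc n) (laplaceTerm M) (adjacent⇒≢ b≡1+a) others cancel
    where
    others : ∀ k → k ≢ a → k ≢ b → laplaceTerm M k ≈ 0#
    others k k≢a k≢b with punchIn-adjacent-preimage k a b b≡1+a k≢a k≢b
    ... | a′ , b′ , k↑a′≡a , k↑b′≡b , b′≡1+a′ =
      laplaceTerm-vanishes M k (det-adjacent-columns n (minor M k) a′ b′ b′≡1+a′ λ i →
        ≡.subst₂ (λ p q → M (suc i) p ≈ M (suc i) q) (≡.sym k↑a′≡a) (≡.sym k↑b′≡b) (columns-equal (suc i)))
    minors-equal : ∀ i j → minor M b i j ≈ minor M a i j
    minors-equal i j with punchIn-adjacent a b b≡1+a j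
    ... | inj₁ same = reflexive (≡.cong (M (suc i)) (≡.sym same))
    ... | inj₂ (a↦b , b↦a) =
      ≡.subst₂ (λ p q → M (suc i) p ≈ M (suc i) q) (≡.sym b↦a) (≡.sym a↦b) (columns-equal (suc i))
    cancel : laplaceTerm M a + laplaceTerm M b ≈ 0#
    cancel = trans
      (+-congˡ (*-cong (reflexive (≡.cong (sgn R) b≡1+a)) (*-cong (sym (columns-equal zero)) (det-cong n minors-equal))))
      (solve 3 (λ s m d → s :* (m :* d) :+ (:- s) :* (m :* d) := O) refl _ _ _)

  -- punchOut without the inequality proof; the value at j = k is junk.
  punchOut′ : ∀ {n} → Fin (suc (suc n)) → Fin (suc (suc n)) → Fin (suc n)
  punchOut′ zero zero = zero
  punchOut′ zero (suc j) = j
  punchOut′ (suc k) zero = zero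
  punchOut′ {zero} (suc k) (suc j) = zero
  punchOut′ {suc n} (suc k) (suc j) = suc (punchOut′ k j)

  punchOut′-punchIn : ∀ {n} (k : Fin (suc (suc n))) l → punchOut′ k (punchIn k l) ≡ l
  punchOut′-punchIn zero l = ≡.refl
  punchOut′-punchIn (suc k) zero = ≡.refl
  punchOut′-punchIn {suc n} (suc k) (suc l) = ≡.cong suc (punchOut′-punchIn k l)

  punchIn-punchOut′-comm : ∀ {n} (k j : Fin (suc (suc n))) → k ≢ j → ∀ b →
                           punchIn k (punchIn (punchOut′ k j) b) ≡ punchIn j (punchIn (punchOut′ j k) b)
  punchIn-punchOut′-comm zero zero k≢j b = contradiction ≡.refl k≢j
  punchIn-punchOut′-comm zero (suc j) k≢j b = ≡.refl
  punchIn-punchOut′-comm (suc k) zero k≢j b = ≡.refl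
  punchIn-punchOut′-comm {suc n} (suc k) (suc j) k≢j zero = ≡.refl
  punchIn-punchOut′-comm {suc n} (suc k) (suc j) k≢j (suc b) =
    ≡.cong suc (punchIn-punchOut′-comm k j (k≢j ∘ ≡.cong suc) b)

  -- (-1)^i where i is the position of j among the columns left after deleting column k; 0 if j = k.
  relativeSign : ∀ {n} → Fin n → Fin n → Carrier
  relativeSign zero zero = 0#
  relativeSign zero (suc j) = sgn R (toℕ j)
  relativeSign (suc k) zero = 1#
  relativeSign (suc k) (suc j) = - relativeSign k j

  relativeSign-punchIn : ∀ {n} (k : Fin (suc n)) l → relativeSign k (punchIn k l) ≡ sgn R (toℕ l)
  relativeSign-punchIn zero l = ≡.refl
  relativeSign-punchIn (suc k) zero = ≡.refl
  relativeSign-punchIn (suc k) (suc l) = ≡.cong -_ (relativeSign-punchIn k l)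

  relativeSign-diagonal : ∀ {n} (k : Fin n) → relativeSign k k ≈ 0#
  relativeSign-diagonal zero = refl
  relativeSign-diagonal (suc k) = trans (-‿cong (relativeSign-diagonal k)) ε⁻¹≈ε

  pairSign : ∀ {n} → Fin n → Fin n → Carrier
  pairSign k j = sgn R (toℕ k) * relativeSign k j

  pairSign-antisymmetric : ∀ {n} (k j : Fin n) → pairSign k j ≈ - pairSign j k
  pairSign-antisymmetric zero zero = solve 0 (I :* O := :- (I :* O)) refl
  pairSign-antisymmetric zero (suc j) = solve 1 (λ s → I :* s := :- ((:- s) :* I)) refl _
  pairSign-antisymmetric (suc k) zero = solve 1 (λ s → (:- s) :* I := :- (I :* s)) refl _
  pairSign-antisymmetric (suc k) (suc j) = begin
    (- sgn R (toℕ k)) * (- relativeSign k j)  ≈⟨ negate-both _ _ ⟩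
    pairSign k j                              ≈⟨ pairSign-antisymmetric k j ⟩
    - pairSign j k                            ≈⟨ -‿cong (negate-both _ _) ⟨
    - ((- sgn R (toℕ j)) * (- relativeSign j k)) ∎
    where
    negate-both : ∀ a b → (- a) * (- b) ≈ a * b
    negate-both = solve 2 (λ a b → (:- a) :* (:- b) := a :* b) refl

  -- Expanding along row 0 and then along row 1 writes det M as ∑ₖ ∑ⱼ g k j with g antisymmetric.
  det-equal-first-rows : ∀ n (M : Matrix (suc (suc n))) → (∀ j → M zero j ≈ M (suc zero) j) →
                         det R (suc (suc n)) M ≈ 0#
  det-equal-first-rows n M rows-equal = begin
    sumFin R (suc (suc n)) (laplaceTerm M)                ≈⟨ ∑-cong (suc (suc n)) {laplaceTerm M} expand ⟩
    sumFin R (suc (suc n)) (λ k → sumFin R (suc (suc n)) (g k))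
      ≈⟨ ∑∑-antisymmetric (suc (suc n)) g g-diagonal g-antisymmetric ⟩
    0#                                                    ∎
    where
    minor₂ : Fin (suc (suc n)) → Fin (suc (suc n)) → Matrix n
    minor₂ k j a b = M (suc (suc a)) (punchIn k (punchIn (punchOut′ k j) b))
    g : Fin (suc (suc n)) → Fin (suc (suc n)) → Carrier
    g k j = pairSign k j * (M zero k * (M zero j * det R n (minor₂ k j)))
    g-diagonal : ∀ k → g k k ≈ 0#
    g-diagonal k = trans (*-congʳ (trans (*-congˡ (relativeSign-diagonal k)) (zeroʳ _))) (zeroˡ _)
    g-antisymmetric : ∀ k j → g k j + g j k ≈ 0#
    g-antisymmetric k j with k Fin.≟ j
    ... | yes ≡.refl = trans (+-cong (g-diagonal k) (g-diagonal k)) (+-identityʳ 0#)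
    ... | no k≢j = trans
      (+-congʳ (*-cong (pairSign-antisymmetric k j) (*-congˡ (*-congˡ (det-cong n λ a b →
         reflexive (≡.cong (M (suc (suc a))) (punchIn-punchOut′-comm k j k≢j b)))))))
      (solve 4 (λ t x y d → (:- t) :* (x :* (y :* d)) :+ t :* (y :* (x :* d)) := O) refl _ _ _ _)
    expand : ∀ k → laplaceTerm M k ≈ sumFin R (suc (suc n)) (g k)
    expand k = begin
      sgn R (toℕ k) * (M zero k * det R (suc n) (minor M k))   ≈⟨ *-assoc _ _ _ ⟨
      (sgn R (toℕ k) * M zero k) * det R (suc n) (minor M k)   ≈⟨ ∑-*ˡ (suc n) _ (laplaceTerm (minor M k)) ⟨
      sumFin R (suc n) (λ l → (sgn R (toℕ k) * M zero k) * laplaceTerm (minor M k) l)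
        ≈⟨ ∑-cong (suc n) {λ l → (sgn R (toℕ k) * M zero k) * laplaceTerm (minor M k) l} (λ l → trans
             (solve 5 (λ s m t b d → (s :* m) :* (t :* (b :* d)) := (s :* t) :* (m :* (b :* d))) refl _ _ _ _ _)
             (*-cong (*-congˡ (reflexive (≡.sym (relativeSign-punchIn k l))))
               (*-congˡ (*-cong (sym (rows-equal _)) (det-cong n λ a b →
                  reflexive (≡.cong (λ p → M (suc (suc a)) (punchIn k (punchIn p b)))
                                    (≡.sym (punchOut′-punchIn k l)))))))) ⟩
      sumFin R (suc n) (λ l → g k (punchIn k l))               ≈⟨ +-identityˡ _ ⟨
      0# + sumFin R (suc n) (λ l → g k (punchIn k l))          ≈⟨ +-congʳ (g-diagonal k) ⟨
      g k k + sumFin R (suc n) (λ l → g k (punchIn k l))       ≈⟨ ∑-punchIn (suc n) k (g k) ⟨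
      sumFin R (suc (suc n)) (g k)                              ∎

  det-adjacent-rows : ∀ n (M : Matrix n) (a b : Fin n) → toℕ b ≡ suc (toℕ a) →
                      (∀ j → M a j ≈ M b j) → det R n M ≈ 0#
  det-adjacent-rows (suc (suc n)) M zero (suc zero) _ rows-equal = det-equal-first-rows n M rows-equal
  det-adjacent-rows (suc n) M (suc a) (suc b) b≡1+a rows-equal = ∑-zero (suc n) λ k →
    laplaceTerm-vanishes M k
      (det-adjacent-rows n (minor M k) a b (ℕ.suc-injective b≡1+a) (rows-equal ∘ punchIn k))

  det-zero-column : ∀ n (M : Matrix n) (c : Fin n) → (∀ i → M i c ≈ 0#) → det R n M ≈ 0#
  det-zero-column n M c column-zero = begin
    det R n M                     ≈⟨ det-column-linear n c (- 1#) (λ _ _ _ → refl) (λ _ _ _ → refl) column-c ⟩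
    det R n M + - 1# * det R n M  ≈⟨ x-x≈0 _ ⟩
    0#                            ∎
    where
    x-x≈0 : ∀ x → x + - 1# * x ≈ 0#
    x-x≈0 = solve 1 (λ x → x :+ (:- I) :* x := O) refl
    column-c : ∀ i → M i c ≈ M i c + - 1# * M i c
    column-c i = trans (column-zero i) (sym (x-x≈0 _))

  det-first-column-zero-below : ∀ n (M : Matrix (suc n)) → (∀ i → M (suc i) zero ≈ 0#) →
                                det R (suc n) M ≈ M zero zero * det R n (minor M zero)
  det-first-column-zero-below zero M _ = trans (+-identityʳ _) (*-identityˡ _)
  det-first-column-zero-below (suc n) M column-zero = begin
    1# * (M zero zero * det R (suc n) (minor M zero)) + sumFin R (suc n) (λ k → laplaceTerm M (suc k))
      ≈⟨ +-cong (*-identityˡ _) (∑-zero (suc n) λ k →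
           laplaceTerm-vanishes M (suc k) (det-zero-column (suc n) (minor M (suc k)) zero column-zero)) ⟩
    M zero zero * det R (suc n) (minor M zero) + 0#
      ≈⟨ +-identityʳ _ ⟩
    M zero zero * det R (suc n) (minor M zero) ∎

  det-first-row-two-entries :
    ∀ n (M : Matrix (suc (suc n))) → (∀ k → M zero (suc (suc k)) ≈ 0#) →
    det R (suc (suc n)) M ≈
      M zero zero * det R (suc n) (minor M zero) - M zero (suc zero) * det R (suc n) (minor M (suc zero))
  det-first-row-two-entries n M row-zero = begin
    1# * (a * d₀) + (- 1# * (b * d₁) + sumFin R n (λ k → laplaceTerm M (suc (suc k))))
      ≈⟨ +-congˡ (+-congˡ (∑-zero n λ k →
           trans (*-congˡ (*-congʳ (row-zero k))) (solve 2 (λ s d → s :* (O :* d) := O) refl _ _))) ⟩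
    1# * (a * d₀) + (- 1# * (b * d₁) + 0#)
      ≈⟨ solve 4 (λ a b d₀ d₁ → I :* (a :* d₀) :+ ((:- I) :* (b :* d₁) :+ O) := a :* d₀ :- b :* d₁) refl a b d₀ d₁ ⟩
    a * d₀ - b * d₁ ∎
    where
    a b d₀ d₁ : Carrier
    a = M zero zero
    b = M zero (suc zero)
    d₀ = det R (suc n) (minor M zero)
    d₁ = det R (suc n) (minor M (suc zero))

  -- The rows (or the columns) of a square matrix, indexed by ℕ so that the neighbours of line k are
  -- simply k ∸ 1 and k ∸ 2; only lines and entries below the size of the matrix are ever looked at.
  Lines : Set c
  Lines = ℕ → ℕ → Carrier

  matrix : ∀ n → Lines → Matrix n
  matrix n L i j = L (toℕ i) (toℕ j)

  _[_≔_] : Lines → ℕ → (ℕ → Carrier) → Lines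
  (L [ r ≔ v ]) k with k ℕ.≟ r
  ... | yes _ = v
  ... | no _ = L k

  update-same : ∀ L r v → (L [ r ≔ v ]) r ≡ v
  update-same L r v with r ℕ.≟ r
  ... | yes _ = ≡.refl
  ... | no r≢r = contradiction ≡.refl r≢r

  update-other : ∀ L {r k} v → k ≢ r → (L [ r ≔ v ]) k ≡ L k
  update-other L {r} {k} v k≢r with k ℕ.≟ r
  ... | yes k≡r = contradiction k≡r k≢r
  ... | no _ = ≡.refl

  update-self : ∀ L r k → (L [ r ≔ L r ]) k ≡ L k
  update-self L r k with k ℕ.≟ r
  ... | yes ≡.refl = ≡.refl
  ... | no _ = ≡.refl

  update-update : ∀ L r v w k → ((L [ r ≔ v ]) [ r ≔ w ]) k ≡ (L [ r ≔ w ]) k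
  update-update L r v w k with k ℕ.≟ r
  ... | yes _ = ≡.refl
  ... | no k≢r = update-other L v k≢r

  update-cong : ∀ L r {v w} → (∀ j → v j ≈ w j) → ∀ k j → (L [ r ≔ v ]) k j ≈ (L [ r ≔ w ]) k j
  update-cong L r v≈w k j with k ℕ.≟ r
  ... | yes _ = v≈w j
  ... | no _ = refl

  -- All lines k ≥ p change at once, each using the original lines k ∸ 1 and k ∸ 2: as a sequence of
  -- line operations this is done from the last line upwards.
  sweep : Carrier → Carrier → ℕ → Lines → Lines
  sweep α β p L k with k ℕ.<? p
  ... | yes _ = L k
  ... | no _ = λ j → L k j + α * L (k ∸ 1) j + β * L (k ∸ 2) j

  sweep-below : ∀ α β {p} L {k} → k < p → sweep α β p L k ≡ L k
  sweep-below α β {p} L {k} k<p with k ℕ.<? p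
  ... | yes _ = ≡.refl
  ... | no k≮p = contradiction k<p k≮p

  sweep-above : ∀ α β {p} L {k} → p ≤ k →
                sweep α β p L k ≡ (λ j → L k j + α * L (k ∸ 1) j + β * L (k ∸ 2) j)
  sweep-above α β {p} L {k} p≤k with k ℕ.<? p
  ... | yes k<p = contradiction p≤k (ℕ.<⇒≱ k<p)
  ... | no _ = ≡.refl

  sweep-suc : ∀ α β {p} L {k} → k ≢ p → sweep α β p L k ≡ sweep α β (suc p) L k
  sweep-suc α β {p} L {k} k≢p with k ℕ.<? p | k ℕ.<? suc p
  ... | yes _ | yes _ = ≡.refl
  ... | no _ | no _ = ≡.refl
  ... | yes k<p | no k≮1+p = contradiction (ℕ.m<n⇒m<1+n k<p) k≮1+p
  ... | no k≮p | yes k<1+p = contradiction (ℕ.≤∧≢⇒< (ℕ.s≤s⁻¹ k<1+p) k≢p) k≮p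

  record IsAlternating (n : ℕ) (Φ : Lines → Carrier) : Set (c ⊔ ℓ) where
    field
      cong : ∀ {L L′} → (∀ k → k < n → ∀ j → L k j ≈ L′ k j) → Φ L ≈ Φ L′
      linear : ∀ {r} → r < n → ∀ L v w α →
               Φ (L [ r ≔ (λ j → v j + α * w j) ]) ≈ Φ (L [ r ≔ v ]) + α * Φ (L [ r ≔ w ])
      adjacent : ∀ {a} → suc a < n → ∀ L → (∀ j → L a j ≈ L (suc a) j) → Φ L ≈ 0#

  matrix-alternating :
    ∀ n (Ψ : Matrix n → Carrier) →
    (∀ {M N} → (∀ i j → M i j ≈ N i j) → Ψ M ≈ Ψ N) →
    (∀ (r : Fin n) α {M N P} →
       (∀ i → i ≢ r → ∀ j → M i j ≈ N i j) → (∀ i → i ≢ r → ∀ j → M i j ≈ P i j) →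
       (∀ j → M r j ≈ N r j + α * P r j) → Ψ M ≈ Ψ N + α * Ψ P) →
    (∀ M (a b : Fin n) → toℕ b ≡ suc (toℕ a) → (∀ j → M a j ≈ M b j) → Ψ M ≈ 0#) →
    IsAlternating n (λ L → Ψ (matrix n L))
  matrix-alternating n Ψ Ψ-cong Ψ-linear Ψ-adjacent = record
    { cong = λ L≈L′ → Ψ-cong λ i j → L≈L′ (toℕ i) (toℕ<n i) (toℕ j)
    ; linear = linear
    ; adjacent = adjacent
    }
    where
    at : ∀ {r} (r<n : r < n) L v → (L [ r ≔ v ]) (toℕ (fromℕ< r<n)) ≡ v
    at {r} r<n L v = ≡.trans (≡.cong (L [ r ≔ v ]) (toℕ-fromℕ< r<n)) (update-same L r v)
    off : ∀ {r} (r<n : r < n) L v i → i ≢ fromℕ< r<n → (L [ r ≔ v ]) (toℕ i) ≡ L (toℕ i)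
    off r<n L v i i≢r = update-other L v λ eq → i≢r (toℕ-injective (≡.trans eq (≡.sym (toℕ-fromℕ< r<n))))
    linear : ∀ {r} → r < n → ∀ L v w α →
             Ψ (matrix n (L [ r ≔ (λ j → v j + α * w j) ])) ≈
             Ψ (matrix n (L [ r ≔ v ])) + α * Ψ (matrix n (L [ r ≔ w ]))
    linear {r} r<n L v w α = Ψ-linear (fromℕ< r<n) α
      {matrix n (L [ r ≔ (λ j → v j + α * w j) ])} {matrix n (L [ r ≔ v ])} {matrix n (L [ r ≔ w ])}
      (λ i i≢r j → reflexive (≡.cong-app (≡.trans (off r<n L _ i i≢r) (≡.sym (off r<n L v i i≢r))) (toℕ j)))
      (λ i i≢r j → reflexive (≡.cong-app (≡.trans (off r<n L _ i i≢r) (≡.sym (off r<n L w i i≢r))) (toℕ j)))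
      (λ j → reflexive (≡.trans (≡.cong-app (at r<n L _) (toℕ j))
               (≡.sym (≡.cong₂ (λ x y → x (toℕ j) + α * y (toℕ j)) (at r<n L v) (at r<n L w)))))
    adjacent : ∀ {a} → suc a < n → ∀ L → (∀ j → L a j ≈ L (suc a) j) → Ψ (matrix n L) ≈ 0#
    adjacent {a} 1+a<n L lines-equal = Ψ-adjacent (matrix n L) (fromℕ< a<n) (fromℕ< 1+a<n)
      (≡.trans (toℕ-fromℕ< 1+a<n) (≡.cong suc (≡.sym (toℕ-fromℕ< a<n))))
      (λ j → ≡.subst₂ (λ p q → L p (toℕ j) ≈ L q (toℕ j))
               (≡.sym (toℕ-fromℕ< a<n)) (≡.sym (toℕ-fromℕ< 1+a<n)) (lines-equal (toℕ j)))
      where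
      a<n : a < n
      a<n = ℕ.<-trans (ℕ.n<1+n a) 1+a<n

  det-rows-alternating : ∀ n → IsAlternating n (λ L → det R n (matrix n L))
  det-rows-alternating n =
    matrix-alternating n (det R n) (det-cong n) (det-row-linear n) (det-adjacent-rows n)

  det-columns-alternating : ∀ n → IsAlternating n (λ L → det R n (flip (matrix n L)))
  det-columns-alternating n =
    matrix-alternating n (det R n ∘ flip) (λ M≈N → det-cong n (flip M≈N))
      (λ c α {M} {N} {P} → det-column-linear n c α {flip M} {flip N} {flip P})
      (λ M → det-adjacent-columns n (flip M))

  module Alternating {n} {Φ : Lines → Carrier} (alt : IsAlternating n Φ) where
    open IsAlternating alt

    VanishesOnEqual : ℕ → ℕ → Set (c ⊔ ℓ)
    VanishesOnEqual r s = ∀ L → (∀ j → L r j ≈ L s j) → Φ L ≈ 0#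

    vanishes-sym : ∀ {r s} → VanishesOnEqual r s → VanishesOnEqual s r
    vanishes-sym vanishes L eq = vanishes L (sym ∘ eq)

    add-multiple : ∀ {r s} → r < n → s ≢ r → VanishesOnEqual r s →
                   ∀ L α → Φ (L [ r ≔ (λ j → L r j + α * L s j) ]) ≈ Φ L
    add-multiple {r} {s} r<n s≢r vanishes L α = begin
      Φ (L [ r ≔ (λ j → L r j + α * L s j) ])        ≈⟨ linear r<n L (L r) (L s) α ⟩
      Φ (L [ r ≔ L r ]) + α * Φ (L [ r ≔ L s ])      ≈⟨ +-cong unchanged (*-congˡ copied) ⟩
      Φ L + α * 0#                                   ≈⟨ trans (+-congˡ (zeroʳ α)) (+-identityʳ _) ⟩
      Φ L                                            ∎
      where
      unchanged : Φ (L [ r ≔ L r ]) ≈ Φ L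
      unchanged = cong λ k _ j → reflexive (≡.cong-app (update-self L r k) j)
      copied : Φ (L [ r ≔ L s ]) ≈ 0#
      copied = vanishes _ λ j →
        reflexive (≡.cong-app (≡.trans (update-same L r (L s)) (≡.sym (update-other L (L s) s≢r))) j)

    -- Lines (ℓ, m, ℓ) at a, a+1, a+2 become (ℓ, m+ℓ, ℓ), (ℓ, m+ℓ, -m) and (ℓ, ℓ, -m).
    vanishes-distance-two : ∀ {a} → suc (suc a) < n → VanishesOnEqual a (suc (suc a))
    vanishes-distance-two {a} a₂<n L a≈a₂ = begin
      Φ L   ≈⟨ add-multiple a₁<n a₂≢a₁ (adjacent a₂<n) L 1# ⟨
      Φ L₁  ≈⟨ add-multiple a₂<n a₁≢a₂ (vanishes-sym (adjacent a₂<n)) L₁ (- 1#) ⟨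
      Φ L₂  ≈⟨ add-multiple a₁<n a₂≢a₁ (adjacent a₂<n) L₂ 1# ⟨
      Φ L₃  ≈⟨ adjacent a₁<n L₃ a≈a₁ ⟩
      0#    ∎
      where
      a₁ a₂ : ℕ
      a₁ = suc a
      a₂ = suc a₁
      a₁<n : a₁ < n
      a₁<n = ℕ.<-trans (ℕ.n<1+n a₁) a₂<n
      a₂≢a₁ : a₂ ≢ a₁
      a₂≢a₁ = ℕ.1+n≢n
      a₁≢a₂ : a₁ ≢ a₂
      a₁≢a₂ = a₂≢a₁ ∘ ≡.sym
      L₁ L₂ L₃ : Lines
      L₁ = L [ a₁ ≔ (λ j → L a₁ j + 1# * L a₂ j) ]
      L₂ = L₁ [ a₂ ≔ (λ j → L₁ a₂ j + - 1# * L₁ a₁ j) ]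
      L₃ = L₂ [ a₁ ≔ (λ j → L₂ a₁ j + 1# * L₂ a₂ j) ]
      L₁a₂≡La₂ : L₁ a₂ ≡ L a₂
      L₁a₂≡La₂ = update-other L _ a₂≢a₁
      L₂a₁≡L₁a₁ : L₂ a₁ ≡ L₁ a₁
      L₂a₁≡L₁a₁ = update-other L₁ _ a₁≢a₂
      L₃a≡La : L₃ a ≡ L a
      L₃a≡La = ≡.trans (update-other L₂ _ (ℕ.m≢1+n+m a {0}))
                 (≡.trans (update-other L₁ _ (ℕ.m≢1+n+m a {1})) (update-other L _ (ℕ.m≢1+n+m a {0})))
      simplify : ∀ x y → (x + 1# * y) + 1# * (y + - 1# * (x + 1# * y)) ≈ y
      simplify = solve 2 (λ x y → (x :+ I :* y) :+ I :* (y :+ (:- I) :* (x :+ I :* y)) := y) refl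
      a≈a₁ : ∀ j → L₃ a j ≈ L₃ a₁ j
      a≈a₁ j = begin
        L₃ a j     ≡⟨ ≡.cong-app L₃a≡La j ⟩
        L a j      ≈⟨ a≈a₂ j ⟩
        L a₂ j     ≈⟨ simplify (L a₁ j) (L a₂ j) ⟨
        (L a₁ j + 1# * L a₂ j) + 1# * (L a₂ j + - 1# * (L a₁ j + 1# * L a₂ j))
          ≡⟨ ≡.cong (λ p → p + 1# * (L a₂ j + - 1# * p)) (≡.cong-app (update-same L a₁ _) j) ⟨
        L₁ a₁ j + 1# * (L a₂ j + - 1# * L₁ a₁ j)
          ≡⟨ ≡.cong₂ (λ p q → p + 1# * (q + - 1# * L₁ a₁ j))
               (≡.cong-app L₂a₁≡L₁a₁ j) (≡.cong-app L₁a₂≡La₂ j) ⟨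
        L₂ a₁ j + 1# * (L₁ a₂ j + - 1# * L₁ a₁ j)
          ≡⟨ ≡.cong (λ q → L₂ a₁ j + 1# * q) (≡.cong-app (update-same L₁ a₂ _) j) ⟨
        L₂ a₁ j + 1# * L₂ a₂ j
          ≡⟨ ≡.cong-app (update-same L₂ a₁ _) j ⟨
        L₃ a₁ j    ∎

    add-recurrence : ∀ {q} → suc (suc q) < n → ∀ L α β →
                     Φ (L [ suc (suc q) ≔ (λ j → L (suc (suc q)) j + α * L (suc q) j + β * L q j) ]) ≈ Φ L
    add-recurrence {q} r<n L α β = begin
      Φ (L [ r ≔ (λ j → L r j + α * L (suc q) j + β * L q j) ])
        ≈⟨ cong (λ k _ j → update-cong L r v≈ k j) ⟩
      Φ (L [ r ≔ (λ j → L′ r j + β * L′ q j) ])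
        ≈⟨ cong (λ k _ j → reflexive (≡.cong-app (update-update L r _ _ k) j)) ⟨
      Φ (L′ [ r ≔ (λ j → L′ r j + β * L′ q j) ])
        ≈⟨ add-multiple r<n q≢r (vanishes-sym (vanishes-distance-two r<n)) L′ β ⟩
      Φ L′
        ≈⟨ add-multiple r<n (ℕ.1+n≢n ∘ ≡.sym) (vanishes-sym (adjacent r<n)) L α ⟩
      Φ L ∎
      where
      r : ℕ
      r = suc (suc q)
      L′ : Lines
      L′ = L [ r ≔ (λ j → L r j + α * L (suc q) j) ]
      q≢r : q ≢ r
      q≢r = ℕ.m≢1+n+m q {1}
      v≈ : ∀ j → L r j + α * L (suc q) j + β * L q j ≈ L′ r j + β * L′ q j
      v≈ j = reflexive (≡.sym (≡.cong₂ (λ p q → p j + β * q j) (update-same L r _) (update-other L _ q≢r)))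

    sweep-invariant : 2 ≤ n → ∀ α β L → Φ (sweep α β 2 L) ≈ Φ L
    sweep-invariant 2≤n α β L = go (n ∸ 2) 0 (ℕ.m∸n+n≡m 2≤n)
      where
      go : ∀ d q → d ℕ.+ suc (suc q) ≡ n → Φ (sweep α β (suc (suc q)) L) ≈ Φ L
      go zero q ≡.refl = cong λ k k<n j → reflexive (≡.cong-app (sweep-below α β L k<n) j)
      go (suc d) q 1+d+p≡n = begin
        Φ (sweep α β p L)                                     ≈⟨ cong (λ k _ j → split k j) ⟩
        Φ (S [ p ≔ (λ j → S p j + α * S (suc q) j + β * S q j) ])  ≈⟨ add-recurrence p<n S α β ⟩
        Φ S                                                   ≈⟨ go d (suc q) (≡.trans (ℕ.+-suc d _) 1+d+p≡n) ⟩
        Φ L                                                   ∎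
        where
        p : ℕ
        p = suc (suc q)
        S : Lines
        S = sweep α β (suc p) L
        p<n : p < n
        p<n = ℕ.m+n≤o⇒n≤o d (ℕ.≤-reflexive (≡.trans (ℕ.+-suc d p) 1+d+p≡n))
        below : ∀ {k} → k < suc p → S k ≡ L k
        below = sweep-below α β L
        split : ∀ k j → sweep α β p L k j ≈ (S [ p ≔ (λ j → S p j + α * S (suc q) j + β * S q j) ]) k j
        split k j with k ℕ.≟ p
        ... | yes ≡.refl = reflexive (≡.trans (≡.cong-app (sweep-above α β L ℕ.≤-refl) j) (≡.sym
               (≡.cong₂ (λ x y → x + β * y)
                 (≡.cong₂ (λ x y → x + α * y)
                   (≡.cong-app (below (ℕ.n<1+n p)) j) (≡.cong-app (below (ℕ.m<n⇒m<1+n (ℕ.n<1+n (suc q)))) j))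
                 (≡.cong-app (below (ℕ.m<n⇒m<1+n (ℕ.m<n⇒m<1+n (ℕ.n<1+n q)))) j))))
        ... | no k≢p = reflexive (≡.cong-app (sweep-suc α β L k≢p) j)

  tridiagonal : Carrier → Carrier → Lines
  tridiagonal a b zero zero = a
  tridiagonal a b zero (suc zero) = b
  tridiagonal a b zero (suc (suc k)) = 0#
  tridiagonal a b (suc j) (suc k) = tridiagonal a b j k
  tridiagonal a b (suc zero) zero = b
  tridiagonal a b (suc (suc j)) zero = 0#

  det-tridiagonal : ∀ a b m → det R m (matrix m (tridiagonal a b)) ≈ lucas R a (b * b) (suc m)
  det-tridiagonal a b zero = refl
  det-tridiagonal a b (suc zero) = trans (det-first-column-zero-below 0 (matrix 1 (tridiagonal a b)) (λ ()))
    (solve 2 (λ a b → a :* I := a :* I :- (b :* b) :* O) refl a b)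
  det-tridiagonal a b (suc (suc m)) = begin
    det R (suc (suc m)) T
      ≈⟨ det-first-row-two-entries m T (λ _ → refl) ⟩
    a * det R (suc m) (minor T zero) - b * det R (suc m) (minor T (suc zero))
      ≈⟨ +-cong (*-congˡ (det-tridiagonal a b (suc m)))
                (-‿cong (*-congˡ (det-first-column-zero-below m (minor T (suc zero)) (λ _ → refl)))) ⟩
    a * lucas R a (b * b) (suc (suc m)) - b * (b * det R m (matrix m (tridiagonal a b)))
      ≈⟨ +-congˡ (-‿cong (*-congˡ (*-congˡ (det-tridiagonal a b m)))) ⟩
    a * lucas R a (b * b) (suc (suc m)) - b * (b * lucas R a (b * b) (suc m))
      ≈⟨ +-congˡ (-‿cong (*-assoc b b _)) ⟨
    lucas R a (b * b) (suc (suc (suc m))) ∎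
    where
    T : Matrix (suc (suc m))
    T = matrix (suc (suc m)) (tridiagonal a b)

  module LucasToeplitz (x y : Carrier) where
    u : ℕ → Carrier
    u = lucas R x y

    U : Lines
    U j k = u ∣ j - k ∣

    e : Carrier
    e = 1# + y

    T : Lines
    T = tridiagonal (- (two R * x)) e

    v : ℕ → Carrier
    v s = u s + (- x) * u (suc s) + y * u (suc (suc s))

    -- U′ below is U after the column operations; its entries are C, whose column k + 2 is H _ k.
    H : Lines
    H zero k = 0#
    H (suc j) (suc k) = H j k
    H (suc zero) zero = e
    H (suc (suc s)) zero = v s

    reduced : Lines
    reduced zero (suc zero) = 1#
    reduced zero _ = 0#
    reduced (suc zero) zero = 1#
    reduced (suc zero) (suc zero) = 0#
    reduced (suc zero) (suc (suc zero)) = e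
    reduced (suc zero) (suc (suc (suc k))) = 0#
    reduced (suc (suc j)) zero = 0#
    reduced (suc (suc j)) (suc (suc k)) = T j k
    reduced (suc (suc zero)) (suc zero) = e
    reduced (suc (suc (suc j))) (suc zero) = 0#

    u-recurrence : ∀ s → u (suc (suc s)) + (- x) * u (suc s) + y * u s ≈ 0#
    u-recurrence s = solve 4 (λ x y a b → (x :* b :- y :* a) :+ (:- x) :* b :+ y :* a := O) refl x y (u s) (u (suc s))

    v-recurrence : ∀ s → v (suc (suc s)) + (- x) * v (suc s) + y * v s ≈ 0#
    v-recurrence s = solve 4 (λ x y a b →
      let u₂ = x :* b :- y :* a
          u₃ = x :* u₂ :- y :* b
          u₄ = x :* u₃ :- y :* u₂
      in (u₂ :+ (:- x) :* u₃ :+ y :* u₄) :+ (:- x) :* (b :+ (:- x) :* u₂ :+ y :* u₃)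
           :+ y :* (a :+ (:- x) :* b :+ y :* u₂) := O) refl x y (u s) (u (suc s))

    column-sweep : ∀ j k → U j (suc (suc k)) + (- x) * U j (suc k) + y * U j k ≈ H j k
    column-sweep zero k = u-recurrence k
    column-sweep (suc zero) zero = solve 2 (λ x y → I :+ (:- x) :* O :+ y :* I := I :+ y) refl x y
    column-sweep (suc (suc s)) zero =
      reflexive (≡.cong (λ t → u t + (- x) * u (suc s) + y * u (suc (suc s))) (ℕ.∣-∣-identityʳ s))
    column-sweep (suc j) (suc k) = column-sweep j k

    row-sweep : ∀ j k → H (suc (suc j)) k + (- x) * H (suc j) k + y * H j k ≈ T j k
    row-sweep zero zero = solve 2 (λ x y →
      (O :+ (:- x) :* I :+ y :* (x :* I :- y :* O)) :+ (:- x) :* (I :+ y) :+ y :* O := :- ((I :+ I) :* x)) refl x y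
    row-sweep zero (suc zero) = solve 3 (λ x y e → e :+ (:- x) :* O :+ y :* O := e) refl x y e
    row-sweep zero (suc (suc k)) = solve 2 (λ x y → O :+ (:- x) :* O :+ y :* O := O) refl x y
    row-sweep (suc zero) zero = solve 2 (λ x y →
      let u₂ = x :* I :- y :* O
          u₃ = x :* u₂ :- y :* I
      in (I :+ (:- x) :* u₂ :+ y :* u₃) :+ (:- x) :* (O :+ (:- x) :* I :+ y :* u₂) :+ y :* (I :+ y) := I :+ y) refl x y
    row-sweep (suc (suc s)) zero = v-recurrence s
    row-sweep (suc j) (suc k) = row-sweep j k

    row-sweep-of-columns : ∀ j k → U (suc (suc j)) k + (- x) * U (suc j) k + y * U j k ≈ H k j
    row-sweep-of-columns j k = trans (reflexive (≡.cong₂ _+_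
        (≡.cong₂ (λ p q → u p + (- x) * u q) (ℕ.∣-∣-comm (suc (suc j)) k) (ℕ.∣-∣-comm (suc j) k))
        (≡.cong (λ p → y * u p) (ℕ.∣-∣-comm j k))))
      (column-sweep k j)

    C : Lines
    C j zero = U j 0
    C j (suc zero) = U j 1
    C j (suc (suc k)) = H j k

    sweep-front : ∀ L {k} → k < 2 → sweep (- x) y 2 L k ≡ L k
    sweep-front = sweep-below (- x) y

    sweep-back : ∀ L k → sweep (- x) y 2 L (suc (suc k)) ≡ (λ j → L (suc (suc k)) j + (- x) * L (suc k) j + y * L k j)
    sweep-back L k = sweep-above (- x) y L (s≤s (s≤s z≤n))

    U′ : Lines
    U′ = flip (sweep (- x) y 2 (flip U))

    U′≈C : ∀ j k → U′ j k ≈ C j k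
    U′≈C j zero = reflexive (≡.cong-app (sweep-front (flip U) ℕ.z<s) j)
    U′≈C j (suc zero) = reflexive (≡.cong-app (sweep-front (flip U) (s≤s ℕ.z<s)) j)
    U′≈C j (suc (suc k)) = trans (reflexive (≡.cong-app (sweep-back (flip U) k) j)) (column-sweep j k)

    C-row₀ : ∀ k → C 0 k ≡ reduced 0 k
    C-row₀ zero = ≡.refl
    C-row₀ (suc zero) = ≡.refl
    C-row₀ (suc (suc k)) = ≡.refl

    C-row₁ : ∀ k → C 1 k ≡ reduced 1 k
    C-row₁ zero = ≡.refl
    C-row₁ (suc zero) = ≡.refl
    C-row₁ (suc (suc zero)) = ≡.refl
    C-row₁ (suc (suc (suc k))) = ≡.refl

    C-row-sweep : ∀ j k → C (suc (suc j)) k + (- x) * C (suc j) k + y * C j k ≈ reduced (suc (suc j)) k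
    C-row-sweep j zero = row-sweep-of-columns j 0
    C-row-sweep zero (suc zero) = row-sweep-of-columns 0 1
    C-row-sweep (suc j) (suc zero) = row-sweep-of-columns (suc j) 1
    C-row-sweep j (suc (suc k)) = row-sweep j k

    swept≈reduced : ∀ j k → sweep (- x) y 2 U′ j k ≈ reduced j k
    swept≈reduced zero k =
      trans (reflexive (≡.cong-app (sweep-front U′ ℕ.z<s) k)) (trans (U′≈C 0 k) (reflexive (C-row₀ k)))
    swept≈reduced (suc zero) k =
      trans (reflexive (≡.cong-app (sweep-front U′ (s≤s ℕ.z<s)) k)) (trans (U′≈C 1 k) (reflexive (C-row₁ k)))
    swept≈reduced (suc (suc j)) k = begin
      sweep (- x) y 2 U′ (suc (suc j)) k                     ≡⟨ ≡.cong-app (sweep-back U′ j) k ⟩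
      U′ (suc (suc j)) k + (- x) * U′ (suc j) k + y * U′ j k
        ≈⟨ +-cong (+-cong (U′≈C _ k) (*-congˡ (U′≈C _ k))) (*-congˡ (U′≈C j k)) ⟩
      C (suc (suc j)) k + (- x) * C (suc j) k + y * C j k    ≈⟨ C-row-sweep j k ⟩
      reduced (suc (suc j)) k                                ∎

    det-reduced : ∀ m → det R (suc (suc m)) (matrix (suc (suc m)) reduced) ≈ - det R m (matrix m T)
    det-reduced m = begin
      det R (suc (suc m)) P
        ≈⟨ det-first-row-two-entries m P (λ _ → refl) ⟩
      0# * det R (suc m) (minor P zero) - 1# * det R (suc m) (minor P (suc zero))
        ≈⟨ +-congˡ (-‿cong (*-congˡ (det-first-column-zero-below m (minor P (suc zero)) (λ _ → refl)))) ⟩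
      0# * det R (suc m) (minor P zero) - 1# * (1# * det R m (matrix m T))
        ≈⟨ solve 2 (λ a t → O :* a :- I :* (I :* t) := :- t) refl _ _ ⟩
      - det R m (matrix m T) ∎
      where
      P : Matrix (suc (suc m))
      P = matrix (suc (suc m)) reduced

    det-lucasToeplitz : ∀ m → det R (suc (suc m)) (lucasToeplitz R x y (suc (suc m))) ≈
                              - lucas R (- (two R * x)) ((1# + y) * (1# + y)) (suc m)
    det-lucasToeplitz m = begin
      det R n (matrix n U)
        ≈⟨ Alternating.sweep-invariant (det-columns-alternating n) 2≤n (- x) y (flip U) ⟨
      det R n (matrix n U′)
        ≈⟨ Alternating.sweep-invariant (det-rows-alternating n) 2≤n (- x) y U′ ⟨
      det R n (matrix n (sweep (- x) y 2 U′))  ≈⟨ det-cong n (λ i j → swept≈reduced (toℕ i) (toℕ j)) ⟩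
      det R n (matrix n reduced)               ≈⟨ det-reduced m ⟩
      - det R m (matrix m T)                   ≈⟨ -‿cong (det-tridiagonal _ e m) ⟩
      - lucas R (- (two R * x)) (e * e) (suc m) ∎
      where
      n : ℕ
      n = suc (suc m)
      2≤n : 2 ≤ n
      2≤n = s≤s (s≤s z≤n)

  lucas-cong : ∀ {x x′ y y′} → x ≈ x′ → y ≈ y′ → ∀ n → lucas R x y n ≈ lucas R x′ y′ n
  lucas-cong x≈x′ y≈y′ zero = refl
  lucas-cong x≈x′ y≈y′ (suc zero) = refl
  lucas-cong x≈x′ y≈y′ (suc (suc n)) =
    +-cong (*-cong x≈x′ (lucas-cong x≈x′ y≈y′ (suc n))) (-‿cong (*-cong y≈y′ (lucas-cong x≈x′ y≈y′ n)))

  lucas-scale : ∀ p x y m → lucas R (p * x) ((p * p) * y) (suc m) ≈ pow R p m * lucas R x y (suc m)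
  lucas-scale p x y zero = solve 0 (I := I :* I) refl
  lucas-scale p x y (suc zero) =
    solve 3 (λ p x y → (p :* x) :* I :- ((p :* p) :* y) :* O := (p :* I) :* (x :* I :- y :* O)) refl p x y
  lucas-scale p x y (suc (suc m)) = begin
    (p * x) * lucas R (p * x) ((p * p) * y) (suc (suc m)) - ((p * p) * y) * lucas R (p * x) ((p * p) * y) (suc m)
      ≈⟨ +-cong (*-congˡ (lucas-scale p x y (suc m))) (-‿cong (*-congˡ (lucas-scale p x y m))) ⟩
    (p * x) * ((p * pow R p m) * u₂) - ((p * p) * y) * (pow R p m * u₁)
      ≈⟨ solve 6 (λ p x y q a b → (p :* x) :* ((p :* q) :* b) :- ((p :* p) :* y) :* (q :* a)
                                := (p :* (p :* q)) :* (x :* b :- y :* a)) refl p x y (pow R p m) u₁ u₂ ⟩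
    pow R p (suc (suc m)) * (x * u₂ - y * u₁) ∎
    where
    u₁ u₂ : Carrier
    u₁ = lucas R x y (suc m)
    u₂ = lucas R x y (suc (suc m))

  lucas-period-three : ∀ n → lucas R (- 1#) 1# (3 ℕ.+ n) ≈ lucas R (- 1#) 1# n
  lucas-period-three n = solve 2 (λ a b → (:- I) :* ((:- I) :* b :- I :* a) :- I :* b := a) refl
                                  (lucas R (- 1#) 1# n) (lucas R (- 1#) 1# (suc n))

  legendre-mod : ∀ m n → m ℕ.% 3 ≡ n ℕ.% 3 → legendre1-n/3 R m ≡ legendre1-n/3 R n
  legendre-mod m n eq with m ℕ.% 3 | n ℕ.% 3 | eq
  ... | zero | .zero | ≡.refl = ≡.refl
  ... | suc zero | .(suc zero) | ≡.refl = ≡.refl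
  ... | suc (suc r) | .(suc (suc r)) | ≡.refl = ≡.refl

  legendre-period-three : ∀ n → legendre1-n/3 R (3 ℕ.+ n) ≡ legendre1-n/3 R n
  legendre-period-three n =
    legendre-mod (3 ℕ.+ n) n (≡.trans (≡.cong (ℕ._% 3) (ℕ.+-comm 3 n)) ([m+n]%n≡m%n n 3))

  legendre-lucas : ∀ m → legendre1-n/3 R (suc (suc m)) ≈ - lucas R (- 1#) 1# (suc m)
  legendre-lucas zero = refl
  legendre-lucas (suc zero) = solve 0 (I := :- ((:- I) :* I :- I :* O)) refl
  legendre-lucas (suc (suc zero)) = solve 0 (O := :- ((:- I) :* ((:- I) :* I :- I :* O) :- I :* I)) refl
  legendre-lucas (suc (suc (suc m))) = begin
    legendre1-n/3 R (3 ℕ.+ suc (suc m))  ≡⟨ legendre-period-three (suc (suc m)) ⟩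
    legendre1-n/3 R (suc (suc m))        ≈⟨ legendre-lucas m ⟩
    - lucas R (- 1#) 1# (suc m)          ≈⟨ -‿cong (lucas-period-three (suc m)) ⟨
    - lucas R (- 1#) 1# (3 ℕ.+ suc m)    ∎

  det-lucasToeplitz-square : ∀ A y → (1# + y) * (1# + y) ≈ (two R * A) * (two R * A) → ∀ m →
    det R (suc (suc m)) (lucasToeplitz R A y (suc (suc m))) ≈ legendre1-n/3 R (suc (suc m)) * pow R (two R * A) m
  det-lucasToeplitz-square A y square m = begin
    det R (suc (suc m)) (lucasToeplitz R A y (suc (suc m)))
      ≈⟨ LucasToeplitz.det-lucasToeplitz A y m ⟩
    - lucas R (- p) ((1# + y) * (1# + y)) (suc m)
      ≈⟨ -‿cong (lucas-cong (solve 1 (λ p → :- p := p :* (:- I)) refl p)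
                            (trans square (sym (*-identityʳ _))) (suc m)) ⟩
    - lucas R (p * - 1#) ((p * p) * 1#) (suc m)
      ≈⟨ -‿cong (lucas-scale p (- 1#) 1# m) ⟩
    - (pow R p m * lucas R (- 1#) 1# (suc m))
      ≈⟨ solve 2 (λ q l → :- (q :* l) := (:- l) :* q) refl _ _ ⟩
    (- lucas R (- 1#) 1# (suc m)) * pow R p m
      ≈⟨ *-congʳ (legendre-lucas m) ⟨
    legendre1-n/3 R (suc (suc m)) * pow R p m ∎
    where
    p : Carrier
    p = two R * A

  shifted-squares : ∀ p → (1# + (p - 1#)) * (1# + (p - 1#)) ≈ p * p
                        × (1# + (- p - 1#)) * (1# + (- p - 1#)) ≈ p * p
  shifted-squares p =
    solve 1 (λ p → (I :+ (p :- I)) :* (I :+ (p :- I)) := p :* p) refl p ,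
    solve 1 (λ p → (I :+ (:- p :- I)) :* (I :+ (:- p :- I)) := p :* p) refl p

corollary1p2 : ∀ {c ℓ : Level} (R : CommutativeRing c ℓ) (A : CommutativeRing.Carrier R) (n : ℕ) → 2 ≤ n →
    let open CommutativeRing R in
      (det R n (lucasToeplitz R A (two R * A - 1#) n) ≈ legendre1-n/3 R n * pow R (two R * A) (n ∸ 2))
      × (det R n (lucasToeplitz R A (- (two R * A) - 1#) n) ≈ legendre1-n/3 R n * pow R (two R * A) (n ∸ 2))
corollary1p2 R A (suc (suc m)) _ =
  det-lucasToeplitz-square R A _ (proj₁ (shifted-squares R _)) m ,
  det-lucasToeplitz-square R A _ (proj₂ (shifted-squares R _)) m
corollary1p2 R A (suc zero) (s≤s ())
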